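{- Let $a,b$ be propositional variables and let $\mathrm{Ax}=G((a\wedge\neg Xa)\Leftrightarrow Xb)\wedge(\neg a\Leftrightarrow b)$. Let $\sigma$ be an LTL interpretation which is an initial segment of length $n$ for $a$ (i.e. $(a,t)\in\sigma$ iff $t<n$) and such that $\sigma,0\models\mathrm{Ax}$. Then for every $t\in\mathbb N$, $\sigma,t\models b$ if and only if $t=n$.
   Context: LTL interpretations are sets $\sigma\subseteq\mathcal P\times\mathbb N$. Semantics: $\sigma,t\models p$ iff $(p,t)\in\sigma$; Boolean connectives as usual; $\sigma,t\models X\phi$ iff $\sigma,t+1\models\phi$; $\sigma,t\models\phi_1U\phi_2$ iff there is $k$ with $\sigma,t+k\models\phi_2$ and $\sigma,t+i\models\phi_1$ for all $i<k$. $G\phi:=\neg(\top U\neg\phi)$ (so $\sigma,t\models G\phi$ iff $\phi$ holds at all times $\ge t$). -}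

module Defs where

open import Data.Nat using (ℕ; _+_; _<_)
open import Data.Bool using (Bool; true)
open import Data.Product using (_×_; Σ)
open import Data.Unit using (⊤)
open import Relation.Nullary using (¬_)
open import Relation.Binary.PropositionalEquality using (_≡_)

data Formula (P : Set) : Set where
  var  : P → Formula P
  tt   : Formula P
  ¬'_  : Formula P → Formula P
  _∧'_ : Formula P → Formula P → Formula P
  X'_  : Formula P → Formula P
  _U'_ : Formula P → Formula P → Formula P

infixr 6 _∧'_
infix 7 ¬'_ X'_

_⇒'_ : {P : Set} → Formula P → Formula P → Formula P
φ ⇒' ψ = ¬' (φ ∧' ¬' ψ)

_⇔'_ : {P : Set} → Formula P → Formula P → Formula P
φ ⇔' ψ = (φ ⇒' ψ) ∧' (ψ ⇒' φ)

G' : {P : Set} → Formula P → Formula P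
G' φ = ¬' (tt U' (¬' φ))

-- An LTL interpretation σ ⊆ P × ℕ, given by its characteristic function:
-- (p , t) ∈ σ  iff  σ p t ≡ true.
Interp : Set → Set
Interp P = P → ℕ → Bool

_,_⊨_ : {P : Set} → Interp P → ℕ → Formula P → Set
σ , t ⊨ var p   = σ p t ≡ true
σ , t ⊨ tt      = ⊤
σ , t ⊨ (¬' φ)  = ¬ (σ , t ⊨ φ)
σ , t ⊨ (φ ∧' ψ) = (σ , t ⊨ φ) × (σ , t ⊨ ψ)
σ , t ⊨ (X' φ)  = σ , (t + 1) ⊨ φ
σ , t ⊨ (φ U' ψ) = Σ ℕ λ k → (σ , (t + k) ⊨ ψ) × (∀ i → i < k → σ , (t + i) ⊨ φ)

Ax : {P : Set} → P → P → Formula P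
Ax a b = G' ((var a ∧' (¬' (X' (var a)))) ⇔' (X' (var b))) ∧' ((¬' (var a)) ⇔' (var b))

InitialSegment : {P : Set} → Interp P → P → ℕ → Set
InitialSegment σ a n = ∀ t → (σ a t ≡ true → t < n) × (t < n → σ a t ≡ true)

-- The G-conjunct says that b holds at t + 1 exactly when t is the last
-- a-instant, and the second conjunct says that b holds at 0 exactly when
-- there is no a-instant at all. For an initial segment of length n both
-- conditions read "the current time is n". Constructively G only yields
-- its body up to double negation, which is harmless since all formulas
-- involved are decidable.
module Submission where

open import Defs
open import Data.Nat using (ℕ; zero; suc; _+_; _<_)
open import Data.Nat.Properties using (+-comm; <-irrefl; ≤-refl; ≮⇒≥; n≤0⇒n≡0; m≤n⇒m<n∨m≡n)
open import Data.Bool using (true) renaming (_≟_ to _≟ᵇ_)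
open import Data.Product using (_×_; _,_; proj₁; proj₂)
open import Data.Sum using (inj₁; inj₂)
open import Data.Unit using (tt)
open import Function using (_∘_; _⇔_; mk⇔; Equivalence)
import Function.Properties.Equivalence as ⇔
open import Relation.Nullary using (¬_; Dec; Stable; _×-dec_; ¬?)
open import Relation.Nullary.Decidable using (decidable-stable)
open import Relation.Nullary.Negation using (contradiction)
open import Relation.Binary.PropositionalEquality using (_≡_; refl; sym; subst)

fallingEdge : {P : Set} → P → Formula P
fallingEdge a = var a ∧' ¬' X' var a

module _ {P : Set} (σ : Interp P) where

  var? : ∀ t p → Dec (σ , t ⊨ var p)
  var? t p = σ p t ≟ᵇ true

  fallingEdge? : ∀ t a → Dec (σ , t ⊨ fallingEdge a)
  fallingEdge? t a = var? t a ×-dec ¬? (var? (t + 1) a)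

  G'-elim : ∀ {t} φ → σ , t ⊨ G' φ → ∀ k → ¬ ¬ (σ , (t + k) ⊨ φ)
  G'-elim φ always k ¬φ = always (k , ¬φ , λ _ _ → tt)

  ⇔'-sound : ∀ {t} φ ψ → Stable (σ , t ⊨ φ) → Stable (σ , t ⊨ ψ) →
             ¬ ¬ (σ , t ⊨ (φ ⇔' ψ)) → (σ , t ⊨ φ) ⇔ (σ , t ⊨ ψ)
  ⇔'-sound φ ψ φ-stable ψ-stable ¬¬φ⇔ψ = mk⇔
    (λ sφ → ψ-stable λ ¬ψ → ¬¬φ⇔ψ λ φ⇔ψ → proj₁ φ⇔ψ (sφ , ¬ψ))
    (λ sψ → φ-stable λ ¬φ → ¬¬φ⇔ψ λ φ⇔ψ → proj₂ φ⇔ψ (sψ , ¬φ))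

  module _ {a b : P} (ax : σ , 0 ⊨ Ax a b) where

    Ax-step : ∀ t → (σ , t ⊨ fallingEdge a) ⇔ (σ , (t + 1) ⊨ var b)
    Ax-step t = ⇔'-sound (fallingEdge a) (X' var b)
      (decidable-stable (fallingEdge? t a)) (decidable-stable (var? (t + 1) b))
      (G'-elim (fallingEdge a ⇔' (X' var b)) (proj₁ ax) t)

    Ax-init : (σ , 0 ⊨ (¬' var a)) ⇔ (σ , 0 ⊨ var b)
    Ax-init = ⇔'-sound (¬' var a) (var b)
      (decidable-stable (¬? (var? 0 a))) (decidable-stable (var? 0 b))
      (contradiction (proj₂ ax))

  module _ {a : P} {n : ℕ} (segment : InitialSegment σ a n) where

    fallingEdge⇔ : ∀ t → (σ , t ⊨ fallingEdge a) ⇔ (t + 1 ≡ n)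
    fallingEdge⇔ t = mk⇔ to from
      where
      to : σ , t ⊨ fallingEdge a → t + 1 ≡ n
      to (at , ¬at+1) with m≤n⇒m<n∨m≡n (proj₁ (segment t) at)
      ... | inj₁ 1+t<n = contradiction (proj₂ (segment (t + 1)) (subst (_< n) (+-comm 1 t) 1+t<n)) ¬at+1
      ... | inj₂ 1+t≡n = subst (_≡ n) (+-comm 1 t) 1+t≡n

      from : t + 1 ≡ n → σ , t ⊨ fallingEdge a
      from refl = proj₂ (segment t) (subst (t <_) (+-comm 1 t) ≤-refl)
                , λ at+1 → <-irrefl refl (proj₁ (segment (t + 1)) at+1)

    never⇔ : (σ , 0 ⊨ (¬' var a)) ⇔ (0 ≡ n)
    never⇔ = mk⇔ to from
      where
      to : ¬ (σ a 0 ≡ true) → 0 ≡ n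
      to ¬a0 = sym (n≤0⇒n≡0 (≮⇒≥ (¬a0 ∘ proj₂ (segment 0))))

      from : 0 ≡ n → ¬ (σ a 0 ≡ true)
      from refl a0 = <-irrefl refl (proj₁ (segment 0) a0)

  b⇔≡n : ∀ {a b n} → InitialSegment σ a n → σ , 0 ⊨ Ax a b →
         ∀ t → (σ , t ⊨ var b) ⇔ (t ≡ n)
  b⇔≡n             segment ax zero    = ⇔.trans (⇔.sym (Ax-init ax)) (never⇔ segment)
  b⇔≡n {b = b} {n} segment ax (suc t) = subst (λ s → (σ , s ⊨ var b) ⇔ (s ≡ n)) (+-comm t 1)
    (⇔.trans (⇔.sym (Ax-step ax t)) (fallingEdge⇔ segment t))

mainTheorem10 : (P : Set) (a b : P) → ¬ (a ≡ b) → (σ : Interp P) (n : ℕ) →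
                  InitialSegment σ a n → σ , 0 ⊨ Ax a b →
                  ∀ t → (σ , t ⊨ var b → t ≡ n) × (t ≡ n → σ , t ⊨ var b)
mainTheorem10 P a b _ σ n segment ax t = Equivalence.to b⇔n , Equivalence.from b⇔n
  where
  b⇔n : (σ , t ⊨ var b) ⇔ (t ≡ n)
  b⇔n = b⇔≡n σ segment ax t
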